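{- For all acyclic graphs $G$ of order $n$, $\operatorname{adim}(G)=\Omega(\sqrt n)$; that is, there is an absolute constant $c>0$ with $\operatorname{adim}(G)\ge c\sqrt n$ for every acyclic graph $G$ of order $n$.
   Context: All graphs are finite, simple and undirected. $d(u,v)$ is graph distance ($\infty$ between different components) and $d_1(u,v)=\min\{d(u,v),2\}$. A set $A\subseteq V(G)$ is an adjacency resolving set of $G$ if for any distinct $x,y\in V(G)$ there is $z\in A$ with $d_1(x,z)\ne d_1(y,z)$; $\operatorname{adim}(G)$ is the minimum size of an adjacency resolving set of $G$. -}

module Defs where

open import Data.Nat using (ℕ; zero; suc; _≤_)
open import Data.Bool using (Bool; true; false)
open import Data.Fin using (Fin; zero; suc; inject₁; fromℕ; _≟_)
open import Data.Fin.Subset using (Subset; _∈_; ∣_∣)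
open import Data.Product using (Σ; ∃; _×_; _,_)
open import Data.Empty using (⊥)
open import Function.Definitions using (Injective)
open import Relation.Nullary using (¬_; yes; no)
open import Relation.Binary.PropositionalEquality using (_≡_; _≢_)

record Graph (n : ℕ) : Set where
  field
    adj    : Fin n → Fin n → Bool
    sym    : ∀ u v → adj u v ≡ adj v u
    irrefl : ∀ u → adj u u ≡ false
open Graph public

Adj : ∀ {n} → Graph n → Fin n → Fin n → Set
Adj G u v = adj G u v ≡ true

Cycle : ∀ {n} → Graph n → Set
Cycle {n} G =
  Σ ℕ λ k → Σ (Fin (suc (suc (suc k))) → Fin n) λ f →
    Injective _≡_ _≡_ f
    × (∀ (i : Fin (suc (suc k))) → Adj G (f (inject₁ i)) (f (suc i)))
    × Adj G (f (fromℕ (suc (suc k)))) (f zero)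

Acyclic : ∀ {n} → Graph n → Set
Acyclic G = ¬ Cycle G

-- d₁(u,v) = min{d(u,v), 2}: 0 if u = v, 1 if u,v adjacent, 2 otherwise
-- (d(u,v) = 0 iff u = v, d(u,v) = 1 iff adjacent, otherwise d(u,v) ≥ 2 or ∞).
d₁ : ∀ {n} → Graph n → Fin n → Fin n → ℕ
d₁ G u v with u ≟ v
... | yes _ = 0
... | no _ with adj G u v
...   | true  = 1
...   | false = 2

IsAdjResolving : ∀ {n} → Graph n → Subset n → Set
IsAdjResolving {n} G A =
  ∀ (x y : Fin n) → x ≢ y → ∃ λ z → z ∈ A × d₁ G x z ≢ d₁ G y z

IsAdim : ∀ {n} → Graph n → ℕ → Set
IsAdim {n} G k =
  (Σ (Subset n) λ A → IsAdjResolving G A × ∣ A ∣ ≡ k)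
  × (∀ (A : Subset n) → IsAdjResolving G A → k ≤ ∣ A ∣)

module Submission where

open import Defs
open import Data.Nat using (ℕ; suc; _≤_; _*_)
open import Data.Product using (Σ)

-- Fix an adjacency resolving set A with ∣A∣ = k; it is nonempty because it
-- separates two vertices.  Every vertex v receives a code: v itself when
-- v ∈ A, and otherwise a summary of its list of neighbours in A — no
-- neighbour, exactly the neighbour a, or first two neighbours a ≠ b.
-- The code map is injective:
--   * two vertices outside A with the same A-neighbourhood coincide, since
--     A resolves them and d₁ to a vertex of A is determined by adjacency;
--   * in an acyclic graph two distinct vertices never share two distinct
--     common neighbours, since these four vertices would form a 4-cycle.
-- All codes lie in an explicit list of length k + k + k² + 1 ≤ 4k², so
-- n ≤ 4k² by the pigeonhole principle.

open import Data.Nat using (zero; _+_; z≤n; s≤s)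
open import Data.Nat.Properties
  using (≤-trans; ≤-refl; m≤m+n; m≤m*n; *-mono-≤; +-mono-≤)
open import Data.Bool using (true; false; if_then_else_)
open import Data.Bool.Properties using (⇔→≡) renaming (_≟_ to _≟ᵇ_)
open import Data.Fin using (Fin; zero; suc; inject₁; _≟_)
open import Data.Fin.Properties using (injective⇒≤)
open import Data.Fin.Subset using (Subset; _∈_; _∉_; ∣_∣; inside; outside)
open import Data.Fin.Subset.Properties using (_∈?_; x∈p⇒∣p-x∣<∣p∣)
open import Data.Vec using ([]; _∷_; here; there)
open import Data.List using (List; []; _∷_; [_]; _++_; map; filter; length;
  allFin; cartesianProductWith; lookup)
open import Data.List.Properties using (length-map; length-++)
open import Data.List.Membership.Propositional using () renaming (_∈_ to _∈ₗ_)
open import Data.List.Membership.Propositional.Properties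
  using (∈-map⁺; ∈-++⁺ˡ; ∈-++⁺ʳ; ∈-filter⁺; ∈-filter⁻; ∈-allFin;
         ∈-cartesianProductWith⁺)
open import Data.List.Relation.Unary.Any using (here; there; index)
open import Data.List.Relation.Unary.Any.Properties using (lookup-index)
open import Data.List.Relation.Unary.AllPairs using (_∷_)
open import Data.List.Relation.Unary.All using (_∷_)
open import Data.List.Relation.Unary.Unique.Propositional using (Unique)
import Data.List.Relation.Unary.Unique.Propositional.Properties as Unique
open import Data.Product using (_,_; _×_; proj₁; proj₂; ∃₂)
open import Data.Sum using (_⊎_; inj₁; inj₂)
open import Data.Empty using (⊥-elim)
open import Function using (_∘_)
open import Function.Bundles using (mk⇔)
open import Function.Definitions using (Injective)
open import Relation.Nullary using (Dec; yes; no)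
open import Relation.Nullary.Decidable using (_×-dec_)
open import Relation.Binary.PropositionalEquality
  using (_≡_; _≢_; refl; trans; cong; cong₂; subst; module ≡-Reasoning)
  renaming (sym to ≡-sym)

-- Pigeonhole for lists: an injection from Fin n whose values all occur in
-- the list xs forces n ≤ length xs (send v to the position of its value).
injection-into-list : ∀ {n} {C : Set} (xs : List C) (g : Fin n → C) →
                      Injective _≡_ _≡_ g → (∀ v → g v ∈ₗ xs) → n ≤ length xs
injection-into-list {n} xs g g-inj g∈xs = injective⇒≤ position-injective
  where
  position : Fin n → Fin (length xs)
  position v = index (g∈xs v)

  position-injective : Injective _≡_ _≡_ position
  position-injective {v} {w} eq = g-inj (begin
    g v                       ≡⟨ lookup-index (g∈xs v) ⟩
    lookup xs (position v)    ≡⟨ cong (lookup xs) eq ⟩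
    lookup xs (position w)    ≡⟨ lookup-index (g∈xs w) ⟨
    g w                       ∎)
    where open ≡-Reasoning

elements : ∀ {n} → Subset n → List (Fin n)
elements []             = []
elements (inside  ∷ p) = zero ∷ map suc (elements p)
elements (outside ∷ p) = map suc (elements p)

length-elements : ∀ {n} (p : Subset n) → length (elements p) ≡ ∣ p ∣
length-elements []            = refl
length-elements (inside  ∷ p) = cong suc (trans (length-map suc (elements p)) (length-elements p))
length-elements (outside ∷ p) = trans (length-map suc (elements p)) (length-elements p)

∈-elements : ∀ {n} {x : Fin n} (p : Subset n) → x ∈ p → x ∈ₗ elements p
∈-elements (inside  ∷ p) here        = here refl
∈-elements (inside  ∷ p) (there x∈p) = there (∈-map⁺ suc (∈-elements p x∈p))
∈-elements (outside ∷ p) (there x∈p) = ∈-map⁺ suc (∈-elements p x∈p)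

member⇒1≤∣p∣ : ∀ {n} {x : Fin n} {p : Subset n} → x ∈ p → 1 ≤ ∣ p ∣
member⇒1≤∣p∣ x∈p = ≤-trans (s≤s z≤n) (x∈p⇒∣p-x∣<∣p∣ x∈p)

data Code (X : Set) : Set where
  landmark  : X → Code X
  isolated  : Code X
  pendant   : X → Code X
  branching : X → X → Code X

codeOf : ∀ {X} → List X → Code X
codeOf []          = isolated
codeOf (a ∷ [])    = pendant a
codeOf (a ∷ b ∷ _) = branching a b

codeOf-collision : ∀ {X} (xs ys : List X) → codeOf xs ≡ codeOf ys →
  xs ≡ ys ⊎ ∃₂ λ a b → ∃₂ λ xs′ ys′ → xs ≡ a ∷ b ∷ xs′ × ys ≡ a ∷ b ∷ ys′
codeOf-collision []          []          refl = inj₁ refl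
codeOf-collision (a ∷ [])    (.a ∷ [])   refl = inj₁ refl
codeOf-collision (a ∷ b ∷ xs) (.a ∷ .b ∷ ys) refl = inj₂ (a , b , xs , ys , refl , refl)
codeOf-collision []          (_ ∷ [])    ()
codeOf-collision []          (_ ∷ _ ∷ _) ()
codeOf-collision (_ ∷ [])    []          ()
codeOf-collision (_ ∷ [])    (_ ∷ _ ∷ _) ()
codeOf-collision (_ ∷ _ ∷ _) []          ()
codeOf-collision (_ ∷ _ ∷ _) (_ ∷ [])    ()

landmark≢codeOf : ∀ {X} {x : X} (xs : List X) → landmark x ≢ codeOf xs
landmark≢codeOf []          ()
landmark≢codeOf (_ ∷ [])    ()
landmark≢codeOf (_ ∷ _ ∷ _) ()

codes : ∀ {X} → List X → List (Code X)
codes L = map landmark L ++ map pendant L ++ cartesianProductWith branching L L ++ [ isolated ]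

length-cartesianProductWith : ∀ {X Y Z : Set} (f : X → Y → Z) (xs : List X) (ys : List Y) →
  length (cartesianProductWith f xs ys) ≡ length xs * length ys
length-cartesianProductWith f []       ys = refl
length-cartesianProductWith f (x ∷ xs) ys =
  trans (length-++ (map (f x) ys))
        (cong₂ _+_ (length-map (f x) ys) (length-cartesianProductWith f xs ys))

length-codes : ∀ {X} (L : List X) →
  length (codes L) ≡ length L + (length L + (length L * length L + 1))
length-codes L =
  trans (length-++ (map landmark L)) (cong₂ _+_ (length-map landmark L)
  (trans (length-++ (map pendant L)) (cong₂ _+_ (length-map pendant L)
  (trans (length-++ (cartesianProductWith branching L L))
         (cong (_+ 1) (length-cartesianProductWith branching L L))))))

landmark-∈-codes : ∀ {X} {x : X} {L : List X} → x ∈ₗ L → landmark x ∈ₗ codes L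
landmark-∈-codes x∈L = ∈-++⁺ˡ (∈-map⁺ landmark x∈L)

codeOf-∈-codes : ∀ {X} (L xs : List X) → (∀ {x} → x ∈ₗ xs → x ∈ₗ L) → codeOf xs ∈ₗ codes L
codeOf-∈-codes L xs xs⊆L = ∈-++⁺ʳ (map landmark L) (lemma xs xs⊆L)
  where
  lemma : ∀ xs → (∀ {x} → x ∈ₗ xs → x ∈ₗ L) →
          codeOf xs ∈ₗ map pendant L ++ cartesianProductWith branching L L ++ [ isolated ]
  lemma []          _   = ∈-++⁺ʳ (map pendant L)
                            (∈-++⁺ʳ (cartesianProductWith branching L L) (here refl))
  lemma (a ∷ [])    ⊆L = ∈-++⁺ˡ (∈-map⁺ pendant (⊆L (here refl)))
  lemma (a ∷ b ∷ _) ⊆L = ∈-++⁺ʳ (map pendant L) (∈-++⁺ˡ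
                            (∈-cartesianProductWith⁺ branching (⊆L (here refl)) (⊆L (there (here refl)))))

codes-count-bound : ∀ k → 1 ≤ k → k + (k + (k * k + 1)) ≤ 4 * (k * k)
codes-count-bound k@(suc _) 1≤k =
  +-mono-≤ k≤k² (+-mono-≤ k≤k² (+-mono-≤ (≤-refl {k * k}) (≤-trans 1≤k² (m≤m+n (k * k) 0))))
  where
  k≤k² : k ≤ k * k
  k≤k² = m≤m*n k k
  1≤k² : 1 ≤ k * k
  1≤k² = *-mono-≤ 1≤k 1≤k

adjacent⇒distinct : ∀ {n} (G : Graph n) {u v : Fin n} → Adj G u v → u ≢ v
adjacent⇒distinct G {u} u~u refl with trans (≡-sym u~u) (irrefl G u)
... | ()

adjacent-sym : ∀ {n} (G : Graph n) {u v : Fin n} → Adj G u v → Adj G v u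
adjacent-sym G {u} {v} u~v = trans (Graph.sym G v u) u~v

d₁-distinct : ∀ {n} (G : Graph n) (u v : Fin n) → u ≢ v →
              d₁ G u v ≡ (if adj G u v then 1 else 2)
d₁-distinct G u v u≢v with u ≟ v
... | yes u≡v = ⊥-elim (u≢v u≡v)
... | no _ with adj G u v
...   | true  = refl
...   | false = refl

resolving-twins : ∀ {n} (G : Graph n) {A : Subset n} → IsAdjResolving G A →
  ∀ {v w} → v ∉ A → w ∉ A → (∀ z → z ∈ A → adj G v z ≡ adj G w z) → v ≡ w
resolving-twins G {A} resolving {v} {w} v∉A w∉A same-adj with v ≟ w
... | yes v≡w = v≡w
... | no v≢w with resolving v w v≢w
...   | z , z∈A , separates = ⊥-elim (separates (begin
  d₁ G v z                      ≡⟨ d₁-distinct G v z (outside≢member v∉A) ⟩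
  (if adj G v z then 1 else 2)  ≡⟨ cong (if_then 1 else 2) (same-adj z z∈A) ⟩
  (if adj G w z then 1 else 2)  ≡⟨ d₁-distinct G w z (outside≢member w∉A) ⟨
  d₁ G w z                      ∎))
  where
  open ≡-Reasoning
  outside≢member : ∀ {x} → x ∉ A → x ≢ z
  outside≢member x∉A refl = x∉A z∈A

-- In an acyclic graph, two vertices with two distinct common neighbours a, b
-- coincide: otherwise v a w b is a 4-cycle.
common-neighbours : ∀ {n} (G : Graph n) → Acyclic G → ∀ {v w a b : Fin n} → a ≢ b →
  Adj G v a → Adj G v b → Adj G w a → Adj G w b → v ≡ w
common-neighbours {n} G acyclic {v} {w} {a} {b} a≢b v~a v~b w~a w~b with v ≟ w
... | yes v≡w = v≡w
... | no v≢w = ⊥-elim (acyclic (1 , square , square-injective , edges , adjacent-sym G v~b))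
  where
  square : Fin 4 → Fin n
  square zero                   = v
  square (suc zero)             = a
  square (suc (suc zero))       = w
  square (suc (suc (suc zero))) = b

  v≢a : v ≢ a
  v≢a = adjacent⇒distinct G v~a
  v≢b : v ≢ b
  v≢b = adjacent⇒distinct G v~b
  w≢a : w ≢ a
  w≢a = adjacent⇒distinct G w~a
  w≢b : w ≢ b
  w≢b = adjacent⇒distinct G w~b

  edges : ∀ (i : Fin 3) → Adj G (square (inject₁ i)) (square (suc i))
  edges zero             = v~a
  edges (suc zero)       = adjacent-sym G w~a
  edges (suc (suc zero)) = w~b

  square-injective : Injective _≡_ _≡_ square
  square-injective {zero}                   {zero}                   _ = refl
  square-injective {zero}                   {suc zero}               e = ⊥-elim (v≢a e)
  square-injective {zero}                   {suc (suc zero)}         e = ⊥-elim (v≢w e)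
  square-injective {zero}                   {suc (suc (suc zero))}   e = ⊥-elim (v≢b e)
  square-injective {suc zero}               {zero}                   e = ⊥-elim (v≢a (≡-sym e))
  square-injective {suc zero}               {suc zero}               _ = refl
  square-injective {suc zero}               {suc (suc zero)}         e = ⊥-elim (w≢a (≡-sym e))
  square-injective {suc zero}               {suc (suc (suc zero))}   e = ⊥-elim (a≢b e)
  square-injective {suc (suc zero)}         {zero}                   e = ⊥-elim (v≢w (≡-sym e))
  square-injective {suc (suc zero)}         {suc zero}               e = ⊥-elim (w≢a e)
  square-injective {suc (suc zero)}         {suc (suc zero)}         _ = refl
  square-injective {suc (suc zero)}         {suc (suc (suc zero))}   e = ⊥-elim (w≢b e)
  square-injective {suc (suc (suc zero))}   {zero}                   e = ⊥-elim (v≢b (≡-sym e))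
  square-injective {suc (suc (suc zero))}   {suc zero}               e = ⊥-elim (a≢b (≡-sym e))
  square-injective {suc (suc (suc zero))}   {suc (suc zero)}         e = ⊥-elim (w≢b (≡-sym e))
  square-injective {suc (suc (suc zero))}   {suc (suc (suc zero))}   _ = refl

module Coding {n : ℕ} (G : Graph n) (acyclic : Acyclic G)
              (A : Subset n) (resolving : IsAdjResolving G A) where

  A-neighbour? : (v z : Fin n) → Dec (z ∈ A × Adj G v z)
  A-neighbour? v z = z ∈? A ×-dec adj G v z ≟ᵇ true

  A-neighbours : Fin n → List (Fin n)
  A-neighbours v = filter (A-neighbour? v) (allFin n)

  ∈-A-neighbours⁻ : ∀ {v z} → z ∈ₗ A-neighbours v → z ∈ A × Adj G v z
  ∈-A-neighbours⁻ {v} z∈ = proj₂ (∈-filter⁻ (A-neighbour? v) {xs = allFin n} z∈)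

  ∈-A-neighbours⁺ : ∀ {v z} → z ∈ A → Adj G v z → z ∈ₗ A-neighbours v
  ∈-A-neighbours⁺ {v} {z} z∈A v~z = ∈-filter⁺ (A-neighbour? v) (∈-allFin z) (z∈A , v~z)

  A-neighbours-unique : ∀ v → Unique (A-neighbours v)
  A-neighbours-unique v = Unique.filter⁺ (A-neighbour? v) (Unique.allFin⁺ n)

  same-A-neighbours : ∀ {v w} → v ∉ A → w ∉ A → A-neighbours v ≡ A-neighbours w → v ≡ w
  same-A-neighbours {v} {w} v∉A w∉A same = resolving-twins G resolving v∉A w∉A same-adj
    where
    same-adj : ∀ z → z ∈ A → adj G v z ≡ adj G w z
    same-adj z z∈A = ⇔→≡ (mk⇔
      (λ v~z → proj₂ (∈-A-neighbours⁻ (subst (z ∈ₗ_) same (∈-A-neighbours⁺ z∈A v~z))))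
      (λ w~z → proj₂ (∈-A-neighbours⁻ (subst (z ∈ₗ_) (≡-sym same) (∈-A-neighbours⁺ z∈A w~z)))))

  shared-first-two : ∀ {v w a b xs ys} →
    A-neighbours v ≡ a ∷ b ∷ xs → A-neighbours w ≡ a ∷ b ∷ ys → v ≡ w
  shared-first-two {v} {w} {a} {b} v-list w-list =
    common-neighbours G acyclic a≢b (neighbour v-list (here refl)) (neighbour v-list (there (here refl)))
                                    (neighbour w-list (here refl)) (neighbour w-list (there (here refl)))
    where
    neighbour : ∀ {u zs z} → A-neighbours u ≡ zs → z ∈ₗ zs → Adj G u z
    neighbour {u} eq z∈ = proj₂ (∈-A-neighbours⁻ (subst (_ ∈ₗ_) (≡-sym eq) z∈))
    a≢b : a ≢ b
    a≢b with subst Unique v-list (A-neighbours-unique v)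
    ... | (a≢b ∷ _) ∷ _ = a≢b

  code : Fin n → Code (Fin n)
  code v with v ∈? A
  ... | yes _ = landmark v
  ... | no  _ = codeOf (A-neighbours v)

  -- Codes are distinct: landmark codes never meet neighbour codes, and equal
  -- neighbour codes come from twins or from a shared pair of neighbours.
  code-injective : Injective _≡_ _≡_ code
  code-injective {v} {w} eq with v ∈? A | w ∈? A
  ... | yes _ | yes _ = landmark-injective eq
    where
    landmark-injective : ∀ {x y : Fin n} → landmark x ≡ landmark y → x ≡ y
    landmark-injective refl = refl
  ... | yes _ | no  _ = ⊥-elim (landmark≢codeOf (A-neighbours w) eq)
  ... | no  _ | yes _ = ⊥-elim (landmark≢codeOf (A-neighbours v) (≡-sym eq))
  ... | no v∉A | no w∉A with codeOf-collision (A-neighbours v) (A-neighbours w) eq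
  ...   | inj₁ same = same-A-neighbours v∉A w∉A same
  ...   | inj₂ (_ , _ , _ , _ , v-list , w-list) = shared-first-two v-list w-list

  code-∈-codes : ∀ v → code v ∈ₗ codes (elements A)
  code-∈-codes v with v ∈? A
  ... | yes v∈A = landmark-∈-codes (∈-elements A v∈A)
  ... | no  _   = codeOf-∈-codes (elements A) (A-neighbours v)
                    (∈-elements A ∘ proj₁ ∘ ∈-A-neighbours⁻)

  order-bound : n ≤ length (codes (elements A))
  order-bound = injection-into-list (codes (elements A)) code code-injective code-∈-codes

corollary4p5 : Σ ℕ λ K → ∀ (n : ℕ) → 2 ≤ n → (G : Graph n) → Acyclic G →
                 ∀ (k : ℕ) → IsAdim G k → n ≤ suc K * (k * k)
corollary4p5 = 3 , bound
  where
  bound : ∀ (n : ℕ) → 2 ≤ n → (G : Graph n) → Acyclic G →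
          ∀ (k : ℕ) → IsAdim G k → n ≤ 4 * (k * k)
  bound (suc zero) (s≤s ()) _ _ _ _
  bound (suc (suc m)) _ G acyclic k ((A , resolving , ∣A∣≡k) , _) = begin
    suc (suc m)                             ≤⟨ Coding.order-bound G acyclic A resolving ⟩
    length (codes (elements A))             ≡⟨ length-codes (elements A) ⟩
    ℓ + (ℓ + (ℓ * ℓ + 1))                   ≡⟨ cong (λ x → x + (x + (x * x + 1))) ℓ≡k ⟩
    k + (k + (k * k + 1))                   ≤⟨ codes-count-bound k 1≤k ⟩
    4 * (k * k)                             ∎
    where
    open Data.Nat.Properties.≤-Reasoning
    ℓ = length (elements A)
    ℓ≡k : ℓ ≡ k
    ℓ≡k = trans (length-elements A) ∣A∣≡k
    1≤k : 1 ≤ k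
    1≤k with resolving zero (suc zero) (λ ())
    ... | _ , z∈A , _ = subst (1 ≤_) ∣A∣≡k (member⇒1≤∣p∣ z∈A)
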